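{- Let $(G,L,\alpha,\beta)$ be a minimum counterexample to the following statement: "for every finite graph $G$ with $\mathrm{mad}(G)<22/9$, every 4-assignment $L$ for $G$, and all $L$-colorings $\alpha,\beta$ of $G$, there is a 14-good $L$-recoloring sequence transforming $\alpha$ to $\beta$." Then $G$ is connected and $\delta(G)\ge 2$.
   Context: $\mathrm{mad}(G):=\max_{H\subseteq G,\,V(H)\neq\emptyset}2|E(H)|/|V(H)|$. A 4-assignment $L$ assigns each vertex $v$ a set $L(v)$ of 4 colors; an $L$-coloring is a proper coloring $\varphi$ with $\varphi(v)\in L(v)$. An $L$-recoloring step changes the color of one vertex so that the result is again a proper $L$-coloring; an $L$-recoloring sequence is an initial $L$-coloring followed by $L$-recoloring steps, and it transforms $\alpha$ to $\beta$ if it starts at $\alpha$ and ends at $\beta$. It is 14-good if each vertex is recolored at most 14 times. A counterexample is a quadruple $(G,L,\alpha,\beta)$ with $\mathrm{mad}(G)<22/9$, $L$ a 4-assignment, $\alpha,\beta$ $L$-colorings, such that no 14-good $L$-recoloring sequence transforms $\alpha$ to $\beta$; a minimum counterexample is one minimizing $|V(G)|$. -}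

module Defs where

open import Data.Nat using (ℕ; zero; suc; _+_; _*_; _<_; _≤_)
open import Data.Nat.Properties using (_≟_)
open import Data.Fin using (Fin)
open import Data.Fin.Subset using (Subset; _∈_; Nonempty; ∣_∣)
open import Data.Bool using (Bool; true; false; if_then_else_)
open import Data.List using (List; allFin; filter; length; map)
open import Data.Nat.ListAction using (sum)
open import Data.Product using (Σ; ∃; _×_; _,_)
open import Relation.Binary.PropositionalEquality using (_≡_; _≢_)
open import Relation.Nullary using (¬_; yes; no)
open import Function.Definitions using (Injective)

record Graph (n : ℕ) : Set where
  field
    adj     : Fin n → Fin n → Bool
    adj-sym : ∀ u v → adj u v ≡ adj v u
    adj-irr : ∀ v → adj v v ≡ false
open Graph public

Adj : ∀ {n} → Graph n → Fin n → Fin n → Set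
Adj G u v = adj G u v ≡ true

degree : ∀ {n} → Graph n → Fin n → ℕ
degree {n} G v = length (filter (λ w → adj G v w Data.Bool.≟ true) (allFin n))

b2i : Bool → ℕ
b2i true = 1
b2i false = 0

inS : ∀ {n} → Subset n → Fin n → Bool
inS S v = Data.Vec.lookup S v
  where import Data.Vec

twiceEdges : ∀ {n} → Graph n → Subset n → ℕ
twiceEdges {n} G S =
  sum (map (λ u → sum (map (λ w →
        b2i (inS S u Data.Bool.∧ inS S w Data.Bool.∧ adj G u w)) (allFin n))) (allFin n))

-- mad(G) < 22/9 : for every nonempty H ⊆ G, 2|E(H)|/|V(H)| < 22/9.
-- Quantifying over induced subgraphs suffices, since for fixed V(H)
-- the induced subgraph has the most edges.
MadLt22/9 : ∀ {n} → Graph n → Set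
MadLt22/9 {n} G = (S : Subset n) → Nonempty S → 9 * twiceEdges G S < 22 * ∣ S ∣

Color : Set
Color = ℕ

Assignment4 : ℕ → Set
Assignment4 n = Fin n → Fin 4 → Color

Is4Assignment : ∀ {n} → Assignment4 n → Set
Is4Assignment L = ∀ v → Injective _≡_ _≡_ (L v)

Coloring : ℕ → Set
Coloring n = Fin n → Color

IsLColoring : ∀ {n} → Graph n → Assignment4 n → Coloring n → Set
IsLColoring G L φ =
  (∀ v → ∃ λ i → L v i ≡ φ v) × (∀ u v → Adj G u v → φ u ≢ φ v)

OneChange : ∀ {n} → Coloring n → Coloring n → Set
OneChange {n} φ ψ = ∃ λ (u : Fin n) → (φ u ≢ ψ u) × (∀ w → w ≢ u → φ w ≡ ψ w)

data RecolSeq {n} (G : Graph n) (L : Assignment4 n) : Coloring n → Coloring n → Set where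
  done : ∀ {φ β} → IsLColoring G L φ → (∀ v → φ v ≡ β v) → RecolSeq G L φ β
  step : ∀ {φ ψ β} → IsLColoring G L φ → OneChange φ ψ → RecolSeq G L ψ β → RecolSeq G L φ β

recolorCount : ∀ {n} {G : Graph n} {L : Assignment4 n} {φ β} →
               RecolSeq G L φ β → Fin n → ℕ
recolorCount (done _ _) v = 0
recolorCount (step {φ = φ} {ψ = ψ} _ _ s) v with φ v ≟ ψ v
... | yes _ = recolorCount s v
... | no _  = suc (recolorCount s v)

Good14 : ∀ {n} {G : Graph n} {L : Assignment4 n} {φ β} → RecolSeq G L φ β → Set
Good14 s = ∀ v → recolorCount s v ≤ 14

Counterexample : ∀ {n} → Graph n → Assignment4 n → Coloring n → Coloring n → Set
Counterexample G L α β =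
  MadLt22/9 G × Is4Assignment L × IsLColoring G L α × IsLColoring G L β ×
  ¬ (Σ (RecolSeq G L α β) Good14)

MinimumCounterexample : ∀ {n} → Graph n → Assignment4 n → Coloring n → Coloring n → Set
MinimumCounterexample {n} G L α β =
  Counterexample G L α β ×
  (∀ m → m < n → (G' : Graph m) (L' : Assignment4 m) (α' β' : Coloring m) →
     ¬ Counterexample G' L' α' β')

data Reach {n} (G : Graph n) : Fin n → Fin n → Set where
  here  : ∀ {v} → Reach G v v
  there : ∀ {u w v} → Adj G u w → Reach G w v → Reach G u v

Connected : ∀ {n} → Graph n → Set
Connected {n} G = ∀ (u v : Fin n) → Reach G u v

{-# OPTIONS --safe #-}
-- A minimum counterexample is minimal under passing to induced subgraphs, which inherit
-- mad < 22/9, so every proper induced subgraph has 14-good recolouring sequences.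
-- If some proper nonempty vertex set were closed under adjacency, recolouring it and then its
-- complement by such sequences would transform α to β.  If a vertex p had at most one
-- neighbour, a 14-good sequence for G - p lifts to G: p is recoloured only just before its
-- neighbour takes p's current colour, and then to a colour of its list avoiding also the
-- neighbour's current and next colour.  So p moves at most once per two neighbour moves plus
-- once at the end, at most 8 times.
module Submission where

open import Defs
open import Data.Nat using (ℕ; _≤_)
open import Data.Fin using (Fin)
open import Data.Product using (_×_)

open import Data.Bool using (Bool; true; false; _∧_; _∨_; if_then_else_) renaming (_≟_ to _≟ᵇ_)
open import Data.Bool.Properties using (¬-not)
open import Data.Empty using (⊥; ⊥-elim)
open import Data.Fin using (zero; suc; punchIn; punchOut) renaming (_≟_ to _≟ᶠ_)
open import Data.Fin.Properties
  using ( any?; pigeonhole; injective⇒≤; suc-injective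
        ; punchIn-injective; punchInᵢ≢i; punchIn-punchOut; punchOut-injective)
open import Data.Fin.Subset using (Subset; _∈_; ∣_∣)
open import Data.List using (List; []; _∷_; _++_; allFin; filter; length; map)
import Data.List.Properties as Listₚ
open import Data.Maybe using (Maybe; just; nothing; fromMaybe)
open import Data.Nat using (zero; suc; _+_; _*_; _<_; z≤n; s≤s)
open import Data.Nat.ListAction using () renaming (sum to sumᴸ)
import Data.Nat.Properties as ℕₚ
open import Algebra.Properties.CommutativeMonoid.Sum ℕₚ.+-0-commutativeMonoid
  using (sum; sum-cong-≗; sum-remove)
open import Data.Product using (Σ; ∃; _,_; proj₁; proj₂; map₁)
open import Data.Sum using (_⊎_; inj₁; inj₂)
open import Data.Vec using (lookup; tabulate)
open import Data.Vec.Properties using (lookup∘tabulate; tabulate∘lookup; lookup⇒[]=; []=⇒lookup)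
open import Data.Vec.Functional using (insertAt)
open import Data.Vec.Functional.Properties using (insertAt-lookup; insertAt-punchIn)
open import Function using (_∘_; const)
open import Function.Definitions using (Injective)
open import Relation.Binary.PropositionalEquality
open import Relation.Nullary using (¬_; Dec; yes; no; does; contradiction)
open import Relation.Nullary.Decidable using (dec-true; dec-false; _×-dec_; ¬?; toWitnessFalse)

sum-zero : ∀ {n} {f : Fin n → ℕ} → (∀ i → f i ≡ 0) → sum f ≡ 0
sum-zero {zero}  f≡0 = refl
sum-zero {suc n} f≡0 = cong₂ _+_ (f≡0 zero) (sum-zero (f≡0 ∘ suc))

sum-mono-≤ : ∀ {n} {f g : Fin n → ℕ} → (∀ i → f i ≤ g i) → sum f ≤ sum g
sum-mono-≤ {zero}  f≤g = z≤n
sum-mono-≤ {suc n} f≤g = ℕₚ.+-mono-≤ (f≤g zero) (sum-mono-≤ (f≤g ∘ suc))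

sum-mono-< : ∀ {n} {f g : Fin n → ℕ} → (∀ i → f i ≤ g i) → ∀ x → f x < g x → sum f < sum g
sum-mono-< {suc n} {f} {g} f≤g x fx<gx =
  subst₂ _<_ (sym (sum-remove f)) (sym (sum-remove g))
    (ℕₚ.+-mono-<-≤ fx<gx (sum-mono-≤ (f≤g ∘ punchIn x)))

≤-sum : ∀ {n} (f : Fin n → ℕ) x → f x ≤ sum f
≤-sum {suc n} f x = subst (f x ≤_) (sym (sum-remove f)) (ℕₚ.m≤m+n (f x) _)

sum-tabulate : ∀ {n} (f : Fin n → ℕ) → sumᴸ (Data.List.tabulate f) ≡ sum f
sum-tabulate {zero}  f = refl
sum-tabulate {suc n} f = cong (f zero +_) (sum-tabulate (f ∘ suc))

sum-allFin : ∀ {n} (f : Fin n → ℕ) → sumᴸ (map f (allFin n)) ≡ sum f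
sum-allFin f = trans (cong sumᴸ (Listₚ.map-tabulate (λ i → i) f)) (sum-tabulate f)

Image : ∀ {m n} → (Fin m → Fin n) → Fin n → Set
Image e x = ∃ λ i → e i ≡ x

image? : ∀ {m n} (e : Fin m → Fin n) x → Dec (Image e x)
image? e x = any? (λ i → e i ≟ᶠ x)

sum-reindex : ∀ {m n} (e : Fin m → Fin n) → Injective _≡_ _≡_ e → (f : Fin n → ℕ) →
              (∀ x → ¬ Image e x → f x ≡ 0) → sum f ≡ sum (f ∘ e)
sum-reindex {zero}  e e-inj f f-out = sum-zero (λ x → f-out x (λ ()))
sum-reindex {suc m} {zero}  e e-inj f f-out with () ← e zero
sum-reindex {suc m} {suc n} e e-inj f f-out = begin
  sum f                            ≡⟨ sum-remove f ⟩
  f x₀ + sum (f ∘ punchIn x₀)      ≡⟨ cong (f x₀ +_) (sum-reindex e′ e′-inj (f ∘ punchIn x₀) f′-out) ⟩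
  f x₀ + sum (f ∘ punchIn x₀ ∘ e′) ≡⟨ cong (f x₀ +_) (sum-cong-≗ (cong f ∘ punchIn-e′)) ⟩
  sum (f ∘ e)                      ∎
  where
  open ≡-Reasoning
  x₀ : Fin (suc n)
  x₀ = e zero
  x₀≢ : ∀ i → x₀ ≢ e (suc i)
  x₀≢ i eq with () ← e-inj eq
  e′ : Fin m → Fin n
  e′ i = punchOut (x₀≢ i)
  punchIn-e′ : ∀ i → punchIn x₀ (e′ i) ≡ e (suc i)
  punchIn-e′ i = punchIn-punchOut (x₀≢ i)
  e′-inj : Injective _≡_ _≡_ e′
  e′-inj eq = suc-injective (e-inj (punchOut-injective (x₀≢ _) (x₀≢ _) eq))
  f′-out : ∀ y → ¬ Image e′ y → f (punchIn x₀ y) ≡ 0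
  f′-out y y∉ = f-out (punchIn x₀ y) λ where
    (zero  , eq) → punchInᵢ≢i x₀ y (sym eq)
    (suc i , eq) → y∉ (i , punchIn-injective x₀ _ _ (trans (punchIn-e′ i) eq))

count : ∀ {n} → (Fin n → Bool) → ℕ
count P = sum (b2i ∘ P)

b2i≤1 : ∀ b → b2i b ≤ 1
b2i≤1 true  = s≤s z≤n
b2i≤1 false = z≤n

count≤n : ∀ {n} (P : Fin n → Bool) → count P ≤ n
count≤n {zero}  P = z≤n
count≤n {suc n} P = ℕₚ.+-mono-≤ (b2i≤1 (P zero)) (count≤n (P ∘ suc))

∣tabulate∣ : ∀ {n} (P : Fin n → Bool) → ∣ tabulate P ∣ ≡ count P
∣tabulate∣ {zero}  P = refl
∣tabulate∣ {suc n} P with P zero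
... | true  = cong suc (∣tabulate∣ (P ∘ suc))
... | false = ∣tabulate∣ (P ∘ suc)

∣∣≡count : ∀ {n} (S : Subset n) → ∣ S ∣ ≡ count (lookup S)
∣∣≡count S = trans (cong ∣_∣ (sym (tabulate∘lookup S))) (∣tabulate∣ (lookup S))

edgeSum : ∀ {n} → Graph n → (Fin n → Bool) → ℕ
edgeSum G P = sum λ u → sum λ w → b2i (P u ∧ P w ∧ adj G u w)

edgeSum-cong : ∀ {n} (G : Graph n) {P Q : Fin n → Bool} → (∀ x → P x ≡ Q x) → edgeSum G P ≡ edgeSum G Q
edgeSum-cong G P≗Q = sum-cong-≗ λ u → sum-cong-≗ λ w →
  cong₂ (λ a b → b2i (a ∧ b ∧ adj G u w)) (P≗Q u) (P≗Q w)

twiceEdges≡edgeSum : ∀ {n} (G : Graph n) (S : Subset n) → twiceEdges G S ≡ edgeSum G (lookup S)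
twiceEdges≡edgeSum {n} G S = trans (sum-allFin {n} _) (sum-cong-≗ {n} λ u → sum-allFin {n} _)

induced : ∀ {m n} → Graph n → (Fin m → Fin n) → Graph m
induced G e = record
  { adj     = λ i j → adj G (e i) (e j)
  ; adj-sym = λ i j → adj-sym G (e i) (e j)
  ; adj-irr = λ i → adj-irr G (e i)
  }

module _ {a} {A : Set a} {m n} (e : Fin m → Fin n) where

  extend : (Fin m → A) → (Fin n → A) → Fin n → A
  extend f g x with image? e x
  ... | yes (i , _) = f i
  ... | no _        = g x

  extend-image : Injective _≡_ _≡_ e → ∀ f g i → extend f g (e i) ≡ f i
  extend-image e-inj f g i with image? e (e i)
  ... | yes (j , eq) = cong f (e-inj eq)
  ... | no  i∉       = contradiction (i , refl) i∉

  extend-outside : ∀ f g x → ¬ Image e x → extend f g x ≡ g x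
  extend-outside f g x x∉ with image? e x
  ... | yes x∈ = contradiction x∈ x∉
  ... | no  _  = refl

  extend-unique : Injective _≡_ _≡_ e → ∀ {f g h} → (∀ i → f i ≡ h (e i)) →
                  (∀ x → ¬ Image e x → g x ≡ h x) → extend f g ≗ h
  extend-unique e-inj {f} {g} f≗h∘e g≗h x with image? e x
  ... | yes (i , refl) = f≗h∘e i
  ... | no  x∉         = g≗h x x∉

module _ {m n} (e : Fin m → Fin n) (e-inj : Injective _≡_ _≡_ e)
         (P : Fin n → Bool) (P-out : ∀ x → ¬ Image e x → P x ≡ false) where

  count-reindex : count P ≡ count (P ∘ e)
  count-reindex = sum-reindex e e-inj (b2i ∘ P) (λ x x∉ → cong b2i (P-out x x∉))

  edgeSum-reindex : (G : Graph n) → edgeSum G P ≡ edgeSum (induced G e) (P ∘ e)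
  edgeSum-reindex G = begin
    edgeSum G P
      ≡⟨ sum-reindex e e-inj _ (λ x x∉ → sum-zero λ w →
           cong (λ b → b2i (b ∧ P w ∧ adj G x w)) (P-out x x∉)) ⟩
    sum (λ i → sum λ w → b2i (P (e i) ∧ P w ∧ adj G (e i) w))
      ≡⟨ sum-cong-≗ (λ i → sum-reindex e e-inj _ λ x x∉ →
           trans (cong (λ b → b2i (P (e i) ∧ b ∧ adj G (e i) x)) (P-out x x∉)) (cong b2i (∧-false (P (e i))))) ⟩
    edgeSum (induced G e) (P ∘ e) ∎
    where
    open ≡-Reasoning
    ∧-false : ∀ b → b ∧ false ≡ false
    ∧-false true  = refl
    ∧-false false = refl

madLt-induced : ∀ {m n} (G : Graph n) (e : Fin m → Fin n) → Injective _≡_ _≡_ e →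
                MadLt22/9 G → MadLt22/9 (induced G e)
madLt-induced {m} {n} G e e-inj mad S′ (i , i∈S′) =
  subst₂ (λ t s → 9 * t < 22 * s) twiceEdges-eq card-eq (mad S (e i , e-i∈S))
  where
  open ≡-Reasoning
  G′ : Graph m
  G′ = induced G e
  P : Fin n → Bool
  P = extend e (lookup S′) (const false)
  S : Subset n
  S = tabulate P
  P∘e≗S′ : ∀ j → P (e j) ≡ lookup S′ j
  P∘e≗S′ = extend-image e e-inj (lookup S′) (const false)
  P-out : ∀ x → ¬ Image e x → P x ≡ false
  P-out = extend-outside e (lookup S′) (const false)
  card-eq : ∣ S ∣ ≡ ∣ S′ ∣
  card-eq = begin
    ∣ S ∣             ≡⟨ ∣tabulate∣ P ⟩
    count P           ≡⟨ count-reindex e e-inj P P-out ⟩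
    count (P ∘ e)     ≡⟨ sum-cong-≗ (cong b2i ∘ P∘e≗S′) ⟩
    count (lookup S′) ≡⟨ sym (∣∣≡count S′) ⟩
    ∣ S′ ∣            ∎
  twiceEdges-eq : twiceEdges G S ≡ twiceEdges G′ S′
  twiceEdges-eq = begin
    twiceEdges G S         ≡⟨ twiceEdges≡edgeSum G S ⟩
    edgeSum G (lookup S)   ≡⟨ edgeSum-cong G (lookup∘tabulate P) ⟩
    edgeSum G P            ≡⟨ edgeSum-reindex e e-inj P P-out G ⟩
    edgeSum G′ (P ∘ e)     ≡⟨ edgeSum-cong G′ P∘e≗S′ ⟩
    edgeSum G′ (lookup S′) ≡⟨ sym (twiceEdges≡edgeSum G′ S′) ⟩
    twiceEdges G′ S′       ∎
  e-i∈S : e i ∈ S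
  e-i∈S = lookup⇒[]= (e i) S (trans (lookup∘tabulate P (e i)) (trans (P∘e≗S′ i) ([]=⇒lookup i∈S′)))

Adj⇒≢ : ∀ {n} (G : Graph n) {x y} → Adj G x y → x ≢ y
Adj⇒≢ G {x} x~y refl with () ← trans (sym x~y) (adj-irr G x)

_[_≔_] : ∀ {n} → Coloring n → Fin n → Color → Coloring n
(φ [ x ≔ c ]) y with y ≟ᶠ x
... | yes _ = c
... | no  _ = φ y

[≔]-at : ∀ {n} (φ : Coloring n) x c → (φ [ x ≔ c ]) x ≡ c
[≔]-at φ x c with x ≟ᶠ x
... | yes _   = refl
... | no  x≢x = contradiction refl x≢x

[≔]-other : ∀ {n} (φ : Coloring n) {x} c {y} → y ≢ x → (φ [ x ≔ c ]) y ≡ φ y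
[≔]-other φ {x} c {y} y≢x with y ≟ᶠ x
... | yes y≡x = contradiction y≡x y≢x
... | no  _   = refl

[≔]-cong : ∀ {n} {φ ψ : Coloring n} x c → φ ≗ ψ → φ [ x ≔ c ] ≗ ψ [ x ≔ c ]
[≔]-cong x c φ≗ψ y with y ≟ᶠ x
... | yes _ = refl
... | no  _ = φ≗ψ y

[≔]-idem : ∀ {n} (φ : Coloring n) {x c} → φ x ≡ c → φ [ x ≔ c ] ≗ φ
[≔]-idem φ {x} φx≡c y with y ≟ᶠ x
... | yes refl = sym φx≡c
... | no  _    = refl

Move : ℕ → Set
Move n = Fin n × Color

recolorings : ∀ {n} → Fin n → List (Move n) → ℕ
recolorings v []             = 0
recolorings v ((x , _) ∷ ms) = b2i (does (v ≟ᶠ x)) + recolorings v ms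

recolorings-++ : ∀ {n} (v : Fin n) ms ms′ →
                 recolorings v (ms ++ ms′) ≡ recolorings v ms + recolorings v ms′
recolorings-++ v []             ms′ = refl
recolorings-++ v ((x , _) ∷ ms) ms′ =
  trans (cong (b2i (does (v ≟ᶠ x)) +_) (recolorings-++ v ms ms′))
        (sym (ℕₚ.+-assoc (b2i (does (v ≟ᶠ x))) _ _))

-- Recolouring sequences as move lists, which unlike RecolSeq are easy to concatenate, lift and count.
module _ {n} (G : Graph n) (L : Assignment4 n) where

  Legal : Coloring n → Move n → Set
  Legal φ (x , c) = (∃ λ i → L x i ≡ c) × (∀ y → Adj G x y → φ y ≢ c)

  infixr 5 _∷_
  data Walk : Coloring n → List (Move n) → Coloring n → Set where
    []  : ∀ {φ β} → φ ≗ β → Walk φ [] β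
    _∷_ : ∀ {φ x c ms β} → Legal φ (x , c) → Walk (φ [ x ≔ c ]) ms β → Walk φ ((x , c) ∷ ms) β

module _ {n} {G : Graph n} {L : Assignment4 n} where

  walk-respˡ : ∀ {φ ψ ms β} → φ ≗ ψ → Walk G L φ ms β → Walk G L ψ ms β
  walk-respˡ φ≗ψ ([] φ≗β)           = [] (λ v → trans (sym (φ≗ψ v)) (φ≗β v))
  walk-respˡ φ≗ψ ((inL , free) ∷ w) =
    (inL , λ y x~y → free y x~y ∘ trans (φ≗ψ y)) ∷ walk-respˡ ([≔]-cong _ _ φ≗ψ) w

  walk-respʳ : ∀ {φ ms β β′} → β ≗ β′ → Walk G L φ ms β → Walk G L φ ms β′
  walk-respʳ β≗β′ ([] φ≗β) = [] (λ v → trans (φ≗β v) (β≗β′ v))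
  walk-respʳ β≗β′ (m ∷ w)  = m ∷ walk-respʳ β≗β′ w

  _++ʷ_ : ∀ {φ γ β ms ms′} → Walk G L φ ms γ → Walk G L γ ms′ β → Walk G L φ (ms ++ ms′) β
  [] φ≗γ ++ʷ w′ = walk-respˡ (sym ∘ φ≗γ) w′
  (m ∷ w) ++ʷ w′ = m ∷ (w ++ʷ w′)

  legal-proper : ∀ {φ x c} → IsLColoring G L φ → Legal G L φ (x , c) → IsLColoring G L (φ [ x ≔ c ])
  legal-proper {φ} {x} {c} (inL , proper) (c∈L , free) = inL′ , proper′
    where
    inL′ : ∀ v → ∃ λ i → L v i ≡ (φ [ x ≔ c ]) v
    inL′ v with v ≟ᶠ x
    ... | yes refl = c∈L
    ... | no  _    = inL v
    proper′ : ∀ u v → Adj G u v → (φ [ x ≔ c ]) u ≢ (φ [ x ≔ c ]) v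
    proper′ u v u~v with u ≟ᶠ x | v ≟ᶠ x
    ... | yes refl | yes refl = contradiction refl (Adj⇒≢ G u~v)
    ... | yes refl | no  _    = free v u~v ∘ sym
    ... | no  _    | yes refl = free u (trans (adj-sym G v u) u~v)
    ... | no  _    | no  _    = proper u v u~v

  recolorCount-step : ∀ {φ ψ β} (isφ : IsLColoring G L φ) (φ⇝ψ : OneChange φ ψ) (s : RecolSeq G L ψ β) v →
                      recolorCount (step isφ φ⇝ψ s) v ≡ b2i (does (v ≟ᶠ proj₁ φ⇝ψ)) + recolorCount s v
  recolorCount-step {φ} {ψ} _ (x , φx≢ψx , same) _ v with φ v ℕₚ.≟ ψ v | v ≟ᶠ x
  ... | yes _     | no  _    = refl
  ... | no  _     | yes _    = refl
  ... | yes φv≡ψv | yes refl = contradiction φv≡ψv φx≢ψx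
  ... | no  φv≢ψv | no  v≢x  = contradiction (same v v≢x) φv≢ψv

  -- Moves that do not change the colour are dropped.
  walk⇒recolSeq : ∀ {φ ms β} → IsLColoring G L φ → Walk G L φ ms β →
                  Σ (RecolSeq G L φ β) λ s → ∀ v → recolorCount s v ≤ recolorings v ms
  walk⇒recolSeq isφ ([] φ≗β) = done isφ φ≗β , λ _ → z≤n
  walk⇒recolSeq {φ} {(x , c) ∷ ms} isφ (legal ∷ w) with φ x ℕₚ.≟ c
  ... | yes φx≡c =
    let s , bound = walk⇒recolSeq isφ (walk-respˡ ([≔]-idem φ φx≡c) w)
    in  s , λ v → ℕₚ.≤-trans (bound v) (ℕₚ.m≤n+m _ _)
  ... | no  φx≢c =
    let s , bound = walk⇒recolSeq (legal-proper isφ legal) w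
    in  step isφ φ⇝ψ s , λ v → subst (_≤ recolorings v ((x , c) ∷ ms)) (sym (recolorCount-step isφ φ⇝ψ s v))
                                   (ℕₚ.+-monoʳ-≤ (b2i (does (v ≟ᶠ x))) (bound v))
    where
    φ⇝ψ : OneChange φ (φ [ x ≔ c ])
    φ⇝ψ = x , (λ eq → φx≢c (trans eq ([≔]-at φ x c))) , (λ w w≢x → sym ([≔]-other φ c w≢x))

  recolSeq-start : ∀ {φ β} → RecolSeq G L φ β → IsLColoring G L φ
  recolSeq-start (done isφ _)   = isφ
  recolSeq-start (step isφ _ _) = isφ

  recolSeq⇒walk : ∀ {φ β} (s : RecolSeq G L φ β) →
                  ∃ λ ms → Walk G L φ ms β × (∀ v → recolorings v ms ≤ recolorCount s v)
  recolSeq⇒walk (done _ φ≗β) = [] , [] φ≗β , λ _ → z≤n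
  recolSeq⇒walk {φ} (step {ψ = ψ} isφ φ⇝ψ@(x , _ , same) s) with recolSeq⇒walk s
  ... | ms , w , bound = (x , ψ x) ∷ ms , (legal ∷ walk-respˡ (sym ∘ φ[x≔ψx]≗ψ) w) , bound′
    where
    isψ : IsLColoring G L ψ
    isψ = recolSeq-start s
    legal : Legal G L φ (x , ψ x)
    legal = proj₁ isψ x , λ y x~y φy≡ψx →
      proj₂ isψ x y x~y (sym (trans (sym (same y (Adj⇒≢ G x~y ∘ sym))) φy≡ψx))
    φ[x≔ψx]≗ψ : φ [ x ≔ ψ x ] ≗ ψ
    φ[x≔ψx]≗ψ y with y ≟ᶠ x
    ... | yes refl = refl
    ... | no  y≢x  = same y y≢x
    bound′ : ∀ v → recolorings v ((x , ψ x) ∷ ms) ≤ recolorCount (step isφ φ⇝ψ s) v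
    bound′ v = subst (recolorings v ((x , ψ x) ∷ ms) ≤_) (sym (recolorCount-step isφ φ⇝ψ s v))
                     (ℕₚ.+-monoʳ-≤ (b2i (does (v ≟ᶠ x))) (bound v))

GoodWalk : ∀ {n} → Graph n → Assignment4 n → Coloring n → Coloring n → Set
GoodWalk G L α β = ∃ λ ms → Walk G L α ms β × (∀ v → recolorings v ms ≤ 14)

counterexample⇒¬goodWalk : ∀ {n} {G : Graph n} {L α β} → Counterexample G L α β → ¬ GoodWalk G L α β
counterexample⇒¬goodWalk (_ , _ , isα , _ , noSeq) (ms , w , good) =
  let s , bound = walk⇒recolSeq isα w in noSeq (s , λ v → ℕₚ.≤-trans (bound v) (good v))

isLColoring-induced : ∀ {m n} (G : Graph n) L {φ} (e : Fin m → Fin n) →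
                      IsLColoring G L φ → IsLColoring (induced G e) (L ∘ e) (φ ∘ e)
isLColoring-induced G L e (inL , proper) = inL ∘ e , λ i j → proper (e i) (e j)

minimal⇒restriction-¬¬goodWalk :
  ∀ {m n} {G : Graph n} {L α β} → MinimumCounterexample G L α β →
  (e : Fin m → Fin n) → Injective _≡_ _≡_ e → m < n →
  ¬ ¬ GoodWalk (induced G e) (L ∘ e) (α ∘ e) (β ∘ e)
minimal⇒restriction-¬¬goodWalk {G = G} {L} {α} {β} ((mad , is4 , isα , isβ , _) , minimal) e e-inj m<n noWalk =
  minimal _ m<n (induced G e) (L ∘ e) (α ∘ e) (β ∘ e)
    ( madLt-induced G e e-inj mad , is4 ∘ e , isLColoring-induced G L e isα , isLColoring-induced G L e isβ
    , λ (s , good) → let ms , w , bound = recolSeq⇒walk s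
                     in  noWalk (ms , w , λ v → ℕₚ.≤-trans (bound v) (good v)))

injective-missing⇒< : ∀ {m n} {e : Fin m → Fin n} → Injective _≡_ _≡_ e → ∀ x → ¬ Image e x → m < n
injective-missing⇒< {n = suc n} {e} e-inj x x∉ =
  s≤s (injective⇒≤ {f = λ i → punchOut (x≢ i)} (e-inj ∘ punchOut-injective (x≢ _) (x≢ _)))
  where
  x≢ : ∀ i → x ≢ e i
  x≢ i x≡ei = x∉ (i , sym x≡ei)

does-≟-injective : ∀ {m n} {e : Fin m → Fin n} → Injective _≡_ _≡_ e →
                   ∀ i j → does (e i ≟ᶠ e j) ≡ does (i ≟ᶠ j)
does-≟-injective {e = e} e-inj i j with i ≟ᶠ j
... | yes i≡j = dec-true (e i ≟ᶠ e j) (cong e i≡j)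
... | no  i≢j = dec-false (e i ≟ᶠ e j) (i≢j ∘ e-inj)

module _ {m n} (e : Fin m → Fin n) (e-inj : Injective _≡_ _≡_ e) where

  liftMoves : List (Move m) → List (Move n)
  liftMoves = map (map₁ e)

  recolorings-liftMoves : ∀ i ms → recolorings (e i) (liftMoves ms) ≡ recolorings i ms
  recolorings-liftMoves i []             = refl
  recolorings-liftMoves i ((j , _) ∷ ms) =
    cong₂ _+_ (cong b2i (does-≟-injective e-inj i j)) (recolorings-liftMoves i ms)

  recolorings-liftMoves-outside : ∀ x ms → ¬ Image e x → recolorings x (liftMoves ms) ≡ 0
  recolorings-liftMoves-outside x []             x∉ = refl
  recolorings-liftMoves-outside x ((j , _) ∷ ms) x∉ =
    cong₂ _+_ (cong b2i (dec-false (x ≟ᶠ e j) (λ x≡ej → x∉ (j , sym x≡ej))))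
              (recolorings-liftMoves-outside x ms x∉)

  [≔]-∘-injective : ∀ (φ : Coloring n) i c → (φ ∘ e) [ i ≔ c ] ≗ (φ [ e i ≔ c ]) ∘ e
  [≔]-∘-injective φ i c j with j ≟ᶠ i
  ... | yes refl = sym ([≔]-at φ (e j) c)
  ... | no  j≢i  = sym ([≔]-other φ c (j≢i ∘ e-inj))

  walk-lift : ∀ (G : Graph n) L → (∀ {i x} → Adj G (e i) x → Image e x) →
              ∀ {φ′ ms β′} φ → φ′ ≗ φ ∘ e → Walk (induced G e) (L ∘ e) φ′ ms β′ →
              Walk G L φ (liftMoves ms) (extend e β′ φ)
  walk-lift G L closed φ φ′≗ ([] φ′≗β′) =
    [] (sym ∘ extend-unique e e-inj (λ i → trans (sym (φ′≗β′ i)) (φ′≗ i)) (λ _ _ → refl))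
  walk-lift G L closed {φ′} {(i , c) ∷ ms} {β′} φ φ′≗ ((c∈L , free) ∷ w) =
    (c∈L , free′) ∷ walk-respʳ tail-end (walk-lift G L closed (φ [ e i ≔ c ]) tail-start w)
    where
    free′ : ∀ y → Adj G (e i) y → φ y ≢ c
    free′ y ei~y with closed ei~y
    ... | j , refl = free j ei~y ∘ trans (φ′≗ j)
    tail-start : φ′ [ i ≔ c ] ≗ (φ [ e i ≔ c ]) ∘ e
    tail-start j = trans ([≔]-cong i c φ′≗ j) ([≔]-∘-injective φ i c j)
    tail-end : extend e β′ (φ [ e i ≔ c ]) ≗ extend e β′ φ
    tail-end = extend-unique e e-inj (sym ∘ extend-image e e-inj β′ φ) λ x x∉ →
      trans ([≔]-other φ c (λ x≡ei → x∉ (i , sym x≡ei))) (sym (extend-outside e β′ φ x x∉))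

record Enumeration {n} (P : Fin n → Bool) (b : Bool) : Set where
  field
    {size}          : ℕ
    index           : Fin size → Fin n
    index-injective : Injective _≡_ _≡_ index
    index-sound     : ∀ i → P (index i) ≡ b
    index-complete  : ∀ x → P x ≡ b → Image index x

enumerate : ∀ {n} (P : Fin n → Bool) b → Enumeration P b
enumerate {zero}  P b = record
  { size = 0 ; index = λ () ; index-injective = λ { {()} } ; index-sound = λ () ; index-complete = λ () }
enumerate {suc n} P b with enumerate (P ∘ suc) b | P zero ≟ᵇ b
... | E | no P₀≢b = record
  { index           = suc ∘ index
  ; index-injective = index-injective ∘ suc-injective
  ; index-sound     = index-sound
  ; index-complete  = λ where
      zero    P₀≡b → contradiction P₀≡b P₀≢b
      (suc x) Px≡b → let i , eq = index-complete x Px≡b in i , cong suc eq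
  }
  where
  open Enumeration E
... | E | yes P₀≡b = record
  { index           = index′
  ; index-injective = λ {i} {j} → injective′ i j
  ; index-sound     = λ where
      zero    → P₀≡b
      (suc i) → index-sound i
  ; index-complete  = λ where
      zero    _    → zero , refl
      (suc x) Px≡b → let i , eq = index-complete x Px≡b in suc i , cong suc eq
  }
  where
  open Enumeration E
  index′ : Fin (suc size) → Fin (suc n)
  index′ zero    = zero
  index′ (suc i) = suc (index i)
  injective′ : ∀ i j → index′ i ≡ index′ j → i ≡ j
  injective′ zero    zero    _  = refl
  injective′ (suc i) (suc j) eq = cong suc (index-injective (suc-injective eq))

Closed : ∀ {n} → Graph n → (Fin n → Bool) → Set
Closed G P = ∀ {u x} → Adj G u x → P u ≡ true → P x ≡ true

module Split {n} (G : Graph n) (L : Assignment4 n) (P : Fin n → Bool) (P-closed : Closed G P) where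

  module A = Enumeration (enumerate P true)
  module B = Enumeration (enumerate P false)

  A-closed : ∀ {i x} → Adj G (A.index i) x → Image A.index x
  A-closed {i} {x} Ai~x = A.index-complete x (P-closed Ai~x (A.index-sound i))

  B-closed : ∀ {i x} → Adj G (B.index i) x → Image B.index x
  B-closed {i} {x} Bi~x with P x in Px
  ... | false = B.index-complete x Px
  ... | true with () ← trans (sym (P-closed (trans (adj-sym G x (B.index i)) Bi~x) Px)) (B.index-sound i)

  covering : ∀ x → Image A.index x ⊎ Image B.index x
  covering x with P x in Px
  ... | true  = inj₁ (A.index-complete x Px)
  ... | false = inj₂ (B.index-complete x Px)

  disjoint : ∀ {x} → Image A.index x → ¬ Image B.index x
  disjoint (i , refl) (j , Bj≡Ai)
    with () ← trans (sym (A.index-sound i)) (trans (cong P (sym Bj≡Ai)) (B.index-sound j))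

  glue : ∀ {α β} →
         GoodWalk (induced G A.index) (L ∘ A.index) (α ∘ A.index) (β ∘ A.index) →
         GoodWalk (induced G B.index) (L ∘ B.index) (α ∘ B.index) (β ∘ B.index) →
         GoodWalk G L α β
  glue {α} {β} (msA , walkA , goodA) (msB , walkB , goodB) =
    movesA ++ movesB , walk-respʳ end (walkA′ ++ʷ walkB′) , good
    where
    movesA movesB : List (Move n)
    movesA = liftMoves A.index A.index-injective msA
    movesB = liftMoves B.index B.index-injective msB
    γ : Coloring n
    γ = extend A.index (β ∘ A.index) α
    walkA′ : Walk G L α movesA γ
    walkA′ = walk-lift A.index A.index-injective G L A-closed α (λ _ → refl) walkA
    walkB′ : Walk G L γ movesB (extend B.index (β ∘ B.index) γ)
    walkB′ = walk-lift B.index B.index-injective G L B-closed γ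
      (λ j → sym (extend-outside A.index (β ∘ A.index) α (B.index j) (λ Bj∈A → disjoint Bj∈A (j , refl))))
      walkB
    end : extend B.index (β ∘ B.index) γ ≗ β
    end = extend-unique B.index B.index-injective (λ _ → refl) λ x x∉B → case (covering x) x∉B
      where
      case : ∀ {x} → Image A.index x ⊎ Image B.index x → ¬ Image B.index x → γ x ≡ β x
      case (inj₁ (i , refl)) _   = extend-image A.index A.index-injective (β ∘ A.index) α i
      case (inj₂ x∈B)        x∉B = contradiction x∈B x∉B
    good : ∀ v → recolorings v (movesA ++ movesB) ≤ 14
    good v rewrite recolorings-++ v movesA movesB with covering v
    ... | inj₁ (i , refl) rewrite recolorings-liftMoves A.index A.index-injective i msA
                                | recolorings-liftMoves-outside B.index B.index-injective _ msB (disjoint (i , refl))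
                                = subst (_≤ 14) (sym (ℕₚ.+-identityʳ _)) (goodA i)
    ... | inj₂ (j , refl) rewrite recolorings-liftMoves B.index B.index-injective j msB
                                | recolorings-liftMoves-outside A.index A.index-injective _ msA
                                    (λ Bj∈A → disjoint Bj∈A (j , refl))
                                = goodB j

minimal⇒noProperClosedSet : ∀ {n} {G : Graph n} {L α β} → MinimumCounterexample G L α β →
                            ∀ (P : Fin n → Bool) {a b} → Closed G P → P a ≡ true → P b ≡ false → ⊥
minimal⇒noProperClosedSet {G = G} {L} mc P {a} {b} P-closed Pa Pb =
  minimal⇒restriction-¬¬goodWalk mc A.index A.index-injective (injective-missing⇒< A.index-injective b b∉A)
    λ goodA → minimal⇒restriction-¬¬goodWalk mc B.index B.index-injective (injective-missing⇒< B.index-injective a a∉B)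
    λ goodB → counterexample⇒¬goodWalk (proj₁ mc) (glue goodA goodB)
  where
  open Split G L P P-closed
  b∉A : ¬ Image A.index b
  b∉A b∈A = disjoint b∈A (B.index-complete b Pb)
  a∉B : ¬ Image B.index a
  a∉B = disjoint (A.index-complete a Pa)

b2i-mono : ∀ {a b} → (a ≡ true → b ≡ true) → b2i a ≤ b2i b
b2i-mono {true}  a⇒b rewrite a⇒b refl = s≤s z≤n
b2i-mono {false} _   = z≤n

reach-snoc : ∀ {n} {G : Graph n} {u w x} → Reach G u w → Adj G w x → Reach G u x
reach-snoc here          w~x = there w~x here
reach-snoc (there u~ r)  w~x = there u~ (reach-snoc r w~x)

module Balls {n} (G : Graph n) (u : Fin n) where

  ball : ℕ → Fin n → Bool
  entering? : ∀ k x → Dec (∃ λ w → ball k w ≡ true × Adj G w x)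

  ball zero    x = does (x ≟ᶠ u)
  ball (suc k) x = ball k x ∨ does (entering? k x)

  entering? k x = any? (λ w → (ball k w ≟ᵇ true) ×-dec (adj G w x ≟ᵇ true))

  ball-sound : ∀ k x → ball k x ≡ true → Reach G u x
  ball-sound zero x _ with x ≟ᶠ u
  ... | yes refl = here
  ball-sound (suc k) x x∈ with ball k x in x∈ₖ
  ... | true = ball-sound k x x∈ₖ
  ... | false with entering? k x
  ...   | yes (w , w∈ , w~x) = reach-snoc (ball-sound k w w∈) w~x

  ball-center : ∀ k → ball k u ≡ true
  ball-center zero    = dec-true (u ≟ᶠ u) refl
  ball-center (suc k) rewrite ball-center k = refl

  ball-⊆-suc : ∀ k x → ball k x ≡ true → ball (suc k) x ≡ true
  ball-⊆-suc k x x∈ rewrite x∈ = refl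

  ball-step : ∀ k {w x} → Adj G w x → ball k w ≡ true → ball (suc k) x ≡ true
  ball-step k {w} {x} w~x w∈ with ball k x
  ... | true  = refl
  ... | false = dec-true (entering? k x) (w , w∈ , w~x)

  -- Until some ball is closed the balls grow strictly, so ball k has more than k vertices.
  closed-or-large : ∀ k → (∃ λ j → Closed G (ball j)) ⊎ k < count (ball k)
  closed-or-large zero = inj₂ (ℕₚ.≤-trans (b2i-mono (λ _ → ball-center 0)) (≤-sum (b2i ∘ ball 0) u))
  closed-or-large (suc k) with closed-or-large k
  ... | inj₁ closed = inj₁ closed
  ... | inj₂ k<count with any? (λ x → (ball (suc k) x ≟ᵇ true) ×-dec (ball k x ≟ᵇ false))
  ...   | yes (x , x∈ , x∉) = inj₂ (ℕₚ.≤-<-trans k<count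
          (sum-mono-< (λ y → b2i-mono (ball-⊆-suc k y)) x
            (subst₂ _<_ (cong b2i (sym x∉)) (cong b2i (sym x∈)) (s≤s z≤n))))
  ...   | no  none          = inj₁ (k , λ w~x w∈ → stable (ball-step k w~x w∈))
    where
    stable : ∀ {x} → ball (suc k) x ≡ true → ball k x ≡ true
    stable {x} x∈ with ball k x ≟ᵇ true
    ... | yes x∈ₖ = x∈ₖ
    ... | no  x∉ₖ = contradiction (x , x∈ , ¬-not x∉ₖ) none

  reachable-closed : ∃ λ P → Closed G P × P u ≡ true × (∀ x → P x ≡ true → Reach G u x)
  reachable-closed with closed-or-large n
  ... | inj₁ (j , closed) = ball j , closed , ball-center j , ball-sound j
  ... | inj₂ n<count      = contradiction (count≤n (ball n)) (ℕₚ.<⇒≱ n<count)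

minimal⇒connected : ∀ {n} {G : Graph n} {L α β} → MinimumCounterexample G L α β → Connected G
minimal⇒connected {G = G} mc u v with Balls.reachable-closed G u
... | P , P-closed , Pu , P⇒reach with P v in Pv
...   | true  = P⇒reach v Pv
...   | false = ⊥-elim (minimal⇒noProperClosedSet mc P P-closed Pu Pv)

length-filter-tabulate : ∀ {k n} (P : Fin n → Bool) (f : Fin k → Fin n) →
                         length (filter (λ w → P w ≟ᵇ true) (Data.List.tabulate f)) ≡ count (P ∘ f)
length-filter-tabulate {zero}  P f = refl
length-filter-tabulate {suc k} P f with P (f zero)
... | true  = cong suc (length-filter-tabulate P (f ∘ suc))
... | false = length-filter-tabulate P (f ∘ suc)

degree≡count : ∀ {n} (G : Graph n) v → degree G v ≡ count (adj G v)
degree≡count G v = length-filter-tabulate (adj G v) (λ w → w)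

degree≤1⇒unique-neighbour : ∀ {n} (G : Graph n) v → degree G v ≤ 1 →
                            ∀ {y z} → Adj G v y → Adj G v z → y ≡ z
degree≤1⇒unique-neighbour {suc n} G v deg≤1 {y} {z} v~y v~z with y ≟ᶠ z
... | yes y≡z = y≡z
... | no  y≢z = contradiction (ℕₚ.≤-trans two≤count (subst (_≤ 1) (degree≡count G v) deg≤1)) (λ { (s≤s ()) })
  where
  f : Fin (suc n) → ℕ
  f = b2i ∘ adj G v
  one≤f : ∀ {x} → Adj G v x → 1 ≤ f x
  one≤f v~x = ℕₚ.≤-reflexive (cong b2i (sym v~x))
  two≤count : 2 ≤ count (adj G v)
  two≤count = begin
    1 + 1                               ≤⟨ ℕₚ.+-mono-≤ (one≤f v~y) (one≤f v~punchIn) ⟩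
    f y + f (punchIn y (punchOut y≢z))  ≤⟨ ℕₚ.+-monoʳ-≤ (f y) (≤-sum (f ∘ punchIn y) (punchOut y≢z)) ⟩
    f y + sum (f ∘ punchIn y)           ≡⟨ sym (sum-remove f) ⟩
    count (adj G v)                     ∎
    where
    open ℕₚ.≤-Reasoning
    v~punchIn : Adj G v (punchIn y (punchOut y≢z))
    v~punchIn = subst (Adj G v) (sym (punchIn-punchOut y≢z)) v~z

avoid-three : ∀ (C : Fin 4 → Color) → Injective _≡_ _≡_ C → ∀ a b c →
              ∃ λ k → C k ≢ a × C k ≢ b × C k ≢ c
avoid-three C C-inj a b c with any? (λ k → ¬? (C k ℕₚ.≟ a) ×-dec ¬? (C k ℕₚ.≟ b) ×-dec ¬? (C k ℕₚ.≟ c))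
... | yes avoiding = avoiding
... | no  none     = ⊥-elim (collision (pigeonhole (ℕₚ.n<1+n 3) (proj₁ ∘ hit)))
  where
  forbidden : Fin 3 → Color
  forbidden zero             = a
  forbidden (suc zero)       = b
  forbidden (suc (suc zero)) = c
  hit : ∀ k → ∃ λ t → C k ≡ forbidden t
  hit k with C k ℕₚ.≟ a | C k ℕₚ.≟ b | C k ℕₚ.≟ c
  ... | yes eq | _      | _      = zero , eq
  ... | no  _  | yes eq | _      = suc zero , eq
  ... | no  _  | no  _  | yes eq = suc (suc zero) , eq
  ... | no  ≢a | no  ≢b | no  ≢c = contradiction (k , ≢a , ≢b , ≢c) none
  collision : ¬ (∃ λ i → ∃ λ j → i Data.Fin.< j × proj₁ (hit i) ≡ proj₁ (hit j))
  collision (i , j , i<j , same) =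
    ℕₚ.<-irrefl (cong Data.Fin.toℕ (C-inj Ci≡Cj)) i<j
    where
    Ci≡Cj : C i ≡ C j
    Ci≡Cj = trans (proj₂ (hit i)) (trans (cong forbidden same) (sym (proj₂ (hit j))))

module Pendant {m} (G : Graph (suc m)) (L : Assignment4 (suc m)) (p : Fin (suc m))
               (L-inj : Injective _≡_ _≡_ (L p))
               (unique : ∀ {y z} → Adj G p y → Adj G p z → y ≡ z)
               (β : Coloring (suc m)) (isβ : IsLColoring G L β) where

  e : Fin m → Fin (suc m)
  e = punchIn p

  e-inj : Injective _≡_ _≡_ e
  e-inj = punchIn-injective p _ _

  e≢p : ∀ j → e j ≢ p
  e≢p = punchInᵢ≢i p

  G′ : Graph m
  G′ = induced G e

  L′ : Assignment4 m
  L′ = L ∘ e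

  vertex-cases : ∀ y → y ≡ p ⊎ Image e y
  vertex-cases y with p ≟ᶠ y
  ... | yes p≡y = inj₁ (sym p≡y)
  ... | no  p≢y = inj₂ (punchOut p≢y , punchIn-punchOut p≢y)

  ≗-by-cases : ∀ {ψ χ : Coloring (suc m)} → ψ p ≡ χ p → (∀ j → ψ (e j) ≡ χ (e j)) → ψ ≗ χ
  ≗-by-cases at-p at-e y with vertex-cases y
  ... | inj₁ refl       = at-p
  ... | inj₂ (j , refl) = at-e j

  insertAt-[≔]-p : ∀ φ′ d d′ → insertAt φ′ p d′ ≗ insertAt φ′ p d [ p ≔ d′ ]
  insertAt-[≔]-p φ′ d d′ = ≗-by-cases
    (trans (insertAt-lookup φ′ p d′) (sym ([≔]-at _ p d′)))
    (λ j → trans (insertAt-punchIn φ′ p d′ j) (sym (trans ([≔]-other _ d′ (e≢p j)) (insertAt-punchIn φ′ p d j))))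

  insertAt-[≔]-e : ∀ φ′ d i c → insertAt (φ′ [ i ≔ c ]) p d ≗ insertAt φ′ p d [ e i ≔ c ]
  insertAt-[≔]-e φ′ d i c = ≗-by-cases
    (trans (insertAt-lookup _ p d) (sym (trans ([≔]-other _ c (e≢p i ∘ sym)) (insertAt-lookup φ′ p d))))
    (λ j → trans (insertAt-punchIn _ p d j)
             (trans ([≔]-cong i c (sym ∘ insertAt-punchIn φ′ p d) j)
                    ([≔]-∘-injective e e-inj (insertAt φ′ p d) i c j)))

  Available : Coloring m → Color → Set
  Available φ′ d = (∃ λ k → L p k ≡ d) × (∀ j → Adj G p (e j) → φ′ j ≢ d)

  legal-p : ∀ {φ′ d d′} → Available φ′ d′ → Legal G L (insertAt φ′ p d) (p , d′)
  legal-p {φ′} {d} (d′∈L , free) = d′∈L , λ y p~y → case (vertex-cases y) p~y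
    where
    case : ∀ {y} → y ≡ p ⊎ Image e y → Adj G p y → insertAt φ′ p d y ≢ _
    case (inj₁ refl)       p~p = contradiction refl (Adj⇒≢ G p~p)
    case (inj₂ (j , refl)) p~ej = free j p~ej ∘ trans (sym (insertAt-punchIn φ′ p d j))

  legal-e : ∀ {φ′ d i c} → Legal G′ L′ φ′ (i , c) → (Adj G p (e i) → c ≢ d) →
            Legal G L (insertAt φ′ p d) (e i , c)
  legal-e {φ′} {d} {i} {c} (c∈L , free) c≢d = c∈L , λ y ei~y → case (vertex-cases y) ei~y
    where
    case : ∀ {y} → y ≡ p ⊎ Image e y → Adj G (e i) y → insertAt φ′ p d y ≢ c
    case (inj₁ refl)       ei~p = c≢d (trans (adj-sym G p (e i)) ei~p) ∘ sym ∘ trans (sym (insertAt-lookup φ′ p d))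
    case (inj₂ (j , refl)) ei~ej = free j ei~ej ∘ trans (sym (insertAt-punchIn φ′ p d j))

  nbr : Fin m → Bool
  nbr i = adj G p (e i)

  nextNbrColor : List (Move m) → Maybe Color
  nextNbrColor []             = nothing
  nextNbrColor ((i , c) ∷ ms) = if nbr i then just c else nextNbrColor ms

  dodge : Color → Color → List (Move m) → Color
  dodge d a ms = L p (proj₁ (avoid-three (L p) L-inj d a (fromMaybe d (nextNbrColor ms))))

  dodge-∈L : ∀ d a ms → ∃ λ k → L p k ≡ dodge d a ms
  dodge-∈L d a ms = proj₁ (avoid-three (L p) L-inj d a (fromMaybe d (nextNbrColor ms))) , refl

  dodge-avoids : ∀ d a ms → dodge d a ms ≢ d × dodge d a ms ≢ a × dodge d a ms ≢ fromMaybe d (nextNbrColor ms)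
  dodge-avoids d a ms = proj₂ (avoid-three (L p) L-inj d a (fromMaybe d (nextNbrColor ms)))

  Forces : Color → Move m → Set
  Forces d (i , c) = Adj G p (e i) × c ≡ d

  forces? : ∀ d mv → Dec (Forces d mv)
  forces? d (i , c) = (adj G p (e i) ≟ᵇ true) ×-dec (c ℕₚ.≟ d)

  insertMoves : Coloring m → Color → List (Move m) → List (Move (suc m))
  insertMoves φ′ d []             = (p , β p) ∷ []
  insertMoves φ′ d ((i , c) ∷ ms) with forces? d (i , c)
  ... | yes _ = (p , d′) ∷ (e i , c) ∷ insertMoves (φ′ [ i ≔ c ]) d′ ms
    where
    d′ : Color
    d′ = dodge d (φ′ i) ms
  ... | no  _ = (e i , c) ∷ insertMoves (φ′ [ i ≔ c ]) d ms

  only-neighbour : ∀ {i j} → Adj G p (e i) → Adj G p (e j) → j ≡ i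
  only-neighbour p~ei p~ej = e-inj (unique p~ej p~ei)

  available-unforced : ∀ {φ′ d i c} → Available φ′ d → ¬ Forces d (i , c) → Available (φ′ [ i ≔ c ]) d
  available-unforced {φ′} {d} {i} {c} (d∈L , free) unforced = d∈L , free′
    where
    free′ : ∀ j → Adj G p (e j) → (φ′ [ i ≔ c ]) j ≢ d
    free′ j p~ej with j ≟ᶠ i
    ... | yes refl = λ c≡d → unforced (p~ej , c≡d)
    ... | no  j≢i  = free j p~ej

  available-dodge : ∀ {φ′ d i ms} → Adj G p (e i) → Available φ′ (dodge d (φ′ i) ms)
  available-dodge {φ′} {d} {i} {ms} p~ei = dodge-∈L d (φ′ i) ms , λ j p~ej →
    subst (λ k → φ′ k ≢ dodge d (φ′ i) ms) (sym (only-neighbour p~ei p~ej))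
      (proj₁ (proj₂ (dodge-avoids d (φ′ i) ms)) ∘ sym)

  available-forced : ∀ {φ′ d i c ms} → Adj G p (e i) → c ≡ d → Available (φ′ [ i ≔ c ]) (dodge d (φ′ i) ms)
  available-forced {φ′} {d} {i} {c} {ms} p~ei c≡d = dodge-∈L d (φ′ i) ms , λ j p~ej →
    subst (λ k → (φ′ [ i ≔ c ]) k ≢ dodge d (φ′ i) ms) (sym (only-neighbour p~ei p~ej))
      λ eq → proj₁ (dodge-avoids d (φ′ i) ms) (trans (sym eq) (trans ([≔]-at φ′ i c) c≡d))

  walk-insert : ∀ {φ′ ms d} → Walk G′ L′ φ′ ms (β ∘ e) → Available φ′ d →
                Walk G L (insertAt φ′ p d) (insertMoves φ′ d ms) β
  walk-insert {φ′} {d = d} ([] φ′≗β) _ = legal-p available ∷ [] end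
    where
    available : Available φ′ (β p)
    available = proj₁ isβ p , λ j p~ej φ′j≡βp → proj₂ isβ p (e j) p~ej (sym (trans (sym (φ′≗β j)) φ′j≡βp))
    end : insertAt φ′ p d [ p ≔ β p ] ≗ β
    end y = trans (sym (insertAt-[≔]-p φ′ d (β p) y))
                  (≗-by-cases (insertAt-lookup φ′ p (β p))
                              (λ j → trans (insertAt-punchIn φ′ p (β p) j) (φ′≗β j)) y)
  walk-insert {φ′} {(i , c) ∷ ms} {d} (legal ∷ w) available with forces? d (i , c)
  ... | yes (p~ei , c≡d) =
    legal-p (available-dodge {ms = ms} p~ei) ∷ walk-respˡ (insertAt-[≔]-p φ′ d d′)
      (legal-e legal (λ _ c≡d′ → proj₁ (dodge-avoids d (φ′ i) ms) (trans (sym c≡d′) c≡d))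
        ∷ walk-respˡ (insertAt-[≔]-e φ′ d′ i c) (walk-insert w (available-forced {ms = ms} p~ei c≡d)))
    where
    d′ : Color
    d′ = dodge d (φ′ i) ms
  ... | no unforced =
    legal-e legal (λ p~ei c≡d → unforced (p~ei , c≡d))
      ∷ walk-respˡ (insertAt-[≔]-e φ′ d i c) (walk-insert w (available-unforced available unforced))

  recolorings-insertMoves-e : ∀ φ′ d ms j → recolorings (e j) (insertMoves φ′ d ms) ≡ recolorings j ms
  recolorings-insertMoves-e φ′ d [] j = cong (λ b → b2i b + 0) (dec-false (e j ≟ᶠ p) (e≢p j))
  recolorings-insertMoves-e φ′ d ((i , c) ∷ ms) j with forces? d (i , c)
  ... | yes _ = cong₂ _+_ (cong b2i (dec-false (e j ≟ᶠ p) (e≢p j)))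
                  (cong₂ _+_ (cong b2i (does-≟-injective e-inj j i)) (recolorings-insertMoves-e _ _ ms j))
  ... | no  _ = cong₂ _+_ (cong b2i (does-≟-injective e-inj j i)) (recolorings-insertMoves-e _ _ ms j)

  nbrMoves : List (Move m) → ℕ
  nbrMoves []             = 0
  nbrMoves ((i , _) ∷ ms) = b2i (nbr i) + nbrMoves ms

  Safe : Color → List (Move m) → Set
  Safe d ms = ∀ {c} → nextNbrColor ms ≡ just c → c ≢ d

  -- After a forced move of p the state is safe, so forced moves are separated by a neighbour move.
  recolorings-insertMoves-p : ∀ φ′ d ms → let N = recolorings p (insertMoves φ′ d ms) in
                              (Safe d ms → N + N ≤ 2 + nbrMoves ms) × N + N ≤ 3 + nbrMoves ms
  recolorings-insertMoves-p φ′ d [] rewrite dec-true (p ≟ᶠ p) refl = (λ _ → ℕₚ.≤-refl) , s≤s (s≤s z≤n)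
  recolorings-insertMoves-p φ′ d ((i , c) ∷ ms) with forces? d (i , c)
  ... | yes (p~ei , c≡d)
      rewrite dec-true (p ≟ᶠ p) refl | dec-false (p ≟ᶠ e i) (e≢p i ∘ sym) | p~ei
      = (λ safe → ⊥-elim (safe refl c≡d))
      , two-more (proj₁ (recolorings-insertMoves-p (φ′ [ i ≔ c ]) d′ ms) safe′)
    where
    d′ : Color
    d′ = dodge d (φ′ i) ms
    safe′ : Safe d′ ms
    safe′ next≡c c≡d′ =
      proj₂ (proj₂ (dodge-avoids d (φ′ i) ms)) (trans (sym c≡d′) (cong (fromMaybe d) (sym next≡c)))
    two-more : ∀ {N K} → N + N ≤ 2 + K → suc N + suc N ≤ 3 + suc K
    two-more {N} {K} N+N≤ = subst (_≤ 3 + suc K) (sym (cong suc (ℕₚ.+-suc N N))) (s≤s (s≤s N+N≤))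
  ... | no _ rewrite dec-false (p ≟ᶠ e i) (e≢p i ∘ sym) with nbr i
  ...   | true  = let _ , N+N≤ = recolorings-insertMoves-p (φ′ [ i ≔ c ]) d ms
                  in  (λ _ → N+N≤) , ℕₚ.≤-trans N+N≤ (ℕₚ.n≤1+n _)
  ...   | false = recolorings-insertMoves-p (φ′ [ i ≔ c ]) d ms

  nbrMoves≤recolorings : ∀ {i₀} → Adj G p (e i₀) → ∀ ms → nbrMoves ms ≤ recolorings i₀ ms
  nbrMoves≤recolorings p~ei₀ []             = z≤n
  nbrMoves≤recolorings {i₀} p~ei₀ ((i , _) ∷ ms) = ℕₚ.+-mono-≤ head≤ (nbrMoves≤recolorings p~ei₀ ms)
    where
    head≤ : b2i (nbr i) ≤ b2i (does (i₀ ≟ᶠ i))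
    head≤ = b2i-mono λ p~ei → dec-true (i₀ ≟ᶠ i) (only-neighbour p~ei p~ei₀)

  nbrMoves-isolated : (∀ i → ¬ Adj G p (e i)) → ∀ ms → nbrMoves ms ≡ 0
  nbrMoves-isolated isolated []             = refl
  nbrMoves-isolated isolated ((i , _) ∷ ms) =
    cong₂ _+_ (cong b2i (¬-not (isolated i))) (nbrMoves-isolated isolated ms)

  nbrMoves≤14 : ∀ ms → (∀ j → recolorings j ms ≤ 14) → nbrMoves ms ≤ 14
  nbrMoves≤14 ms good with any? (λ i → nbr i ≟ᵇ true)
  ... | yes (i₀ , p~ei₀) = ℕₚ.≤-trans (nbrMoves≤recolorings p~ei₀ ms) (good i₀)
  ... | no  isolated     = subst (_≤ 14) (sym (nbrMoves-isolated (λ i p~ei → isolated (i , p~ei)) ms)) z≤n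

  goodWalk-insert : ∀ {α} → IsLColoring G L α → GoodWalk G′ L′ (α ∘ e) (β ∘ e) → GoodWalk G L α β
  goodWalk-insert {α} isα (ms , walk , good) = insertMoves (α ∘ e) (α p) ms , walk′ , good′
    where
    start : insertAt (α ∘ e) p (α p) ≗ α
    start = ≗-by-cases (insertAt-lookup (α ∘ e) p (α p)) (insertAt-punchIn (α ∘ e) p (α p))
    walk′ : Walk G L α (insertMoves (α ∘ e) (α p) ms) β
    walk′ = walk-respˡ start (walk-insert walk (proj₁ isα p , λ j p~ej → proj₂ isα p (e j) p~ej ∘ sym))
    half : ∀ {N K} → N + N ≤ 3 + K → K ≤ 14 → N ≤ 14
    half {N} N+N≤ K≤14 = ℕₚ.≮⇒≥ λ 14<N →
      toWitnessFalse {a? = 30 ℕₚ.≤? 17} _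
        (ℕₚ.≤-trans (ℕₚ.+-mono-≤ 14<N 14<N) (ℕₚ.≤-trans N+N≤ (ℕₚ.+-monoʳ-≤ 3 K≤14)))
    good′ : ∀ y → recolorings y (insertMoves (α ∘ e) (α p) ms) ≤ 14
    good′ y with vertex-cases y
    ... | inj₁ refl       = half (proj₂ (recolorings-insertMoves-p (α ∘ e) (α p) ms)) (nbrMoves≤14 ms good)
    ... | inj₂ (j , refl) = subst (_≤ 14) (sym (recolorings-insertMoves-e (α ∘ e) (α p) ms j)) (good j)

minimal⇒2≤degree : ∀ {n} {G : Graph n} {L α β} → MinimumCounterexample G L α β → ∀ v → 2 ≤ degree G v
minimal⇒2≤degree {suc m} {G} {L} {β = β} mc@((_ , is4 , isα , isβ , _) , _) p with 2 ℕₚ.≤? degree G p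
... | yes 2≤deg = 2≤deg
... | no  2≰deg =
  ⊥-elim (minimal⇒restriction-¬¬goodWalk mc e e-inj (ℕₚ.n<1+n m) λ good →
          counterexample⇒¬goodWalk (proj₁ mc) (goodWalk-insert isα good))
  where
  open Pendant G L p (is4 p) (degree≤1⇒unique-neighbour G p (ℕₚ.≤-pred (ℕₚ.≰⇒> 2≰deg))) β isβ

lemma5 : ∀ {n} (G : Graph n) (L : Assignment4 n) (α β : Coloring n) →
         MinimumCounterexample G L α β →
         Connected G × (∀ (v : Fin n) → 2 ≤ degree G v)
lemma5 G L α β mc = minimal⇒connected mc , minimal⇒2≤degree mc
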